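{- Let $\mathbb{F}$ be a field and $A=(a_{ij})_{1\le i,j\le k}\in\mathbb{F}^{k\times k}$ such that $a_{ii}\neq 0$ and $\det(A_i)\neq 0$ for all $i\in[k]$. For $b\in\mathbb{F}$ and $i\in[k]$ let $A_i^b$ be the matrix obtained from $A_i$ by replacing the entry $a_{ii}$ by $b$. Then there are unique $b_2,\dots,b_k\in\mathbb{F}$ and $d_1,\dots,d_k\in\mathbb{F}$ such that (a) $d_1=a_{11}$, (b) $d_i=(a_{ii}-b_i)d_{i-1}$ for $2\le i\le k$, and (c) $\det(A_i^{b_i})=0$ for $2\le i\le k$. Furthermore, $d_i=\det(A_i)$ for all $i\in[k]$.
   Context: $A_i$ denotes the matrix obtained from $A$ by removing all rows and columns with index larger than $i$ (the leading principal $i\times i$ submatrix). -}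

module Defs where

open import Level using (Level; _⊔_)
open import Data.Nat using (ℕ; zero; suc)
open import Data.Fin using (Fin; zero; suc; toℕ; inject≤; inject₁; punchIn; _≟_)
open import Data.Fin.Properties using (toℕ<n)
open import Data.Bool using (Bool; true; false; _∧_; if_then_else_)
open import Data.Product using (∃; _×_)
open import Relation.Nullary using (¬_)
open import Relation.Nullary.Decidable using (⌊_⌋)
open import Algebra.Bundles using (CommutativeRing)

record Field (c ℓ : Level) : Set (Level.suc (c ⊔ ℓ)) where
  field
    commutativeRing : CommutativeRing c ℓ
  open CommutativeRing commutativeRing public
  field
    0≉1     : ¬ (0# ≈ 1#)
    inverse : ∀ x → ¬ (x ≈ 0#) → ∃ λ y → x * y ≈ 1#

module FieldMatrices {c ℓ : Level} (F : Field c ℓ) where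
  open Field F public using (Carrier; _≈_; _+_; _*_; -_; _-_; 0#; 1#)

  Matrix : ℕ → Set c
  Matrix m = Fin m → Fin m → Carrier

  ∑ : {m : ℕ} → (Fin m → Carrier) → Carrier
  ∑ {zero}  f = 0#
  ∑ {suc m} f = f zero + ∑ (λ j → f (suc j))

  sgn : {m : ℕ} → Fin m → Carrier
  sgn zero    = 1#
  sgn (suc j) = - sgn j

  minor : {m : ℕ} → Matrix (suc m) → Fin (suc m) → Matrix m
  minor M j r s = M (suc r) (punchIn j s)

  det : {m : ℕ} → Matrix m → Carrier
  det {zero}  M = 1#
  det {suc m} M = ∑ (λ j → sgn j * (M zero j * det (minor M j)))

  -- leading principal submatrix A_i: for the (0-based) index i : Fin k,
  -- keep rows/columns 0..i, giving a (toℕ i + 1)×(toℕ i + 1) matrix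
  -- (this is A_{i+1} in the paper's 1-based notation)
  lead : {k : ℕ} → Matrix k → (i : Fin k) → Matrix (suc (toℕ i))
  lead {k} M i r s = M (inject≤ r (toℕ<n i)) (inject≤ s (toℕ<n i))

  setDiag : {k : ℕ} → Matrix k → Fin k → Carrier → Matrix k
  setDiag M i b r s = if ⌊ r ≟ i ⌋ ∧ ⌊ s ≟ i ⌋ then b else M r s

  leadWith : {k : ℕ} → Matrix k → (i : Fin k) → Carrier → Matrix (suc (toℕ i))
  leadWith M i b = lead (setDiag M i b) i

  -- conditions (a),(b),(c) of the proposition for A of size k = n+1;
  -- b j stands for b_{j+2} (j : Fin n), d i stands for d_{i+1} (i : Fin (n+1))
  Conds : {n : ℕ} → Matrix (suc n) → (Fin n → Carrier) → (Fin (suc n) → Carrier) → Set ℓ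
  Conds A b d = (d zero ≈ A zero zero)
              × (∀ j → d (suc j) ≈ (A (suc j) (suc j) - b j) * d (inject₁ j))
              × (∀ j → det (leadWith A (suc j) (b j)) ≈ 0#)

module Submission where

-- Everything rests on one fact about determinants (det-corner): the
-- determinant of a square matrix is an affine function of its bottom-right
-- entry, whose slope is the determinant of the top-left block.  Stated
-- without subtraction: if M and M' differ only in the corner entry, then
--   det M' + M_corner · det(topLeft M)  ≈  det M + M'_corner · det(topLeft M),
-- proved by induction on the size through the first-row Laplace expansion.
-- For A_{j+1} and A_{j+1}^x this reads
--   det(A_{j+1}^x) + a · D_j  ≈  D_{j+1} + x · D_j       (a = a_{j+1,j+1}),
-- so det(A_{j+1}^x) = 0 iff (a - x)·D_j = D_{j+1}.  Since D_j is invertible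
-- this linear equation has the unique root x = a - D_{j+1}·D_j⁻¹, which is
-- therefore the only possible b_{j+1}; with it, (a) and (b) force d = D by
-- induction on the index.

open import Defs
open import Level using (Level)
open import Data.Nat using (ℕ; zero; suc)
open import Data.Nat.Properties using (<-irrefl)
open import Data.Fin using (Fin; zero; suc; toℕ; inject₁; inject≤; fromℕ; punchIn; _≟_)
open import Data.Fin.Properties using (toℕ-injective; toℕ-inject₁; toℕ-inject≤; toℕ-fromℕ; toℕ<n)
open import Data.Fin.Induction using (<-weakInduction)
open import Data.Fin.Relation.Unary.Top using (View; view; ‵fromℕ; ‵inject₁)
open import Data.Product using (Σ; _×_; _,_; proj₁; proj₂)
open import Data.Empty using (⊥-elim)
open import Function using (_∘_)
open import Function.Bundles using (_⇔_; mk⇔; module Equivalence)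
open import Relation.Nullary using (¬_; yes; no)
open import Relation.Binary.PropositionalEquality as ≡ using (_≡_; _≢_)
open import Algebra.Bundles using (CommutativeRing)

open Equivalence using (to; from)

-- How punchIn interacts with the embedding inject₁ and with the top index
-- fromℕ; these identify the minors of a top-left block with the top-left
-- blocks of minors.
punchIn-inject₁ : ∀ {m} (j : Fin (suc m)) (s : Fin m) →
                  punchIn (inject₁ j) (inject₁ s) ≡ inject₁ (punchIn j s)
punchIn-inject₁ zero    s       = ≡.refl
punchIn-inject₁ (suc j) zero    = ≡.refl
punchIn-inject₁ (suc j) (suc s) = ≡.cong suc (punchIn-inject₁ j s)

punchIn-inject₁-fromℕ : ∀ {m} (j : Fin (suc m)) → punchIn (inject₁ j) (fromℕ m) ≡ fromℕ (suc m)
punchIn-inject₁-fromℕ         zero    = ≡.refl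
punchIn-inject₁-fromℕ {suc m} (suc j) = ≡.cong suc (punchIn-inject₁-fromℕ j)

punchIn-fromℕ : ∀ {m} (s : Fin m) → punchIn (fromℕ m) s ≡ inject₁ s
punchIn-fromℕ {suc m} zero    = ≡.refl
punchIn-fromℕ {suc m} (suc s) = ≡.cong suc (punchIn-fromℕ s)

module LinearEquations {c ℓ : Level} (R : CommutativeRing c ℓ) where
  open CommutativeRing R
  open import Algebra.Properties.Ring ring using ([y-z]x≈yx-zx)
  open import Algebra.Properties.Group +-group using (x≈z//y; //-rightDividesˡ)
  open import Algebra.Properties.AbelianGroup +-abelianGroup using (⁻¹-anti-homo‿-; xyx⁻¹≈y)
  open import Relation.Binary.Reasoning.Setoid setoid

  [a-x]p≈u⇔u+xp≈ap : ∀ a x p u → (a - x) * p ≈ u ⇔ u + x * p ≈ a * p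
  [a-x]p≈u⇔u+xp≈ap a x p u = mk⇔
    (λ eq → begin
      u + x * p                 ≈⟨ +-congʳ eq ⟨
      (a - x) * p + x * p       ≈⟨ +-congʳ ([y-z]x≈yx-zx p a x) ⟩
      (a * p - x * p) + x * p   ≈⟨ //-rightDividesˡ (x * p) (a * p) ⟩
      a * p                     ∎)
    (λ eq → begin
      (a - x) * p               ≈⟨ [y-z]x≈yx-zx p a x ⟩
      a * p - x * p             ≈⟨ x≈z//y u (x * p) (a * p) eq ⟨
      u                         ∎)

  a-[a-x]≈x : ∀ a x → a - (a - x) ≈ x
  a-[a-x]≈x a x = begin
    a - (a - x)       ≈⟨ +-congˡ (⁻¹-anti-homo‿- a x) ⟩
    a + (x - a)       ≈⟨ +-assoc a x (- a) ⟨
    a + x - a         ≈⟨ xyx⁻¹≈y a x ⟩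
    x                 ∎

  qp≈u⇔q≈uy : ∀ {p y} → p * y ≈ 1# → ∀ q u → q * p ≈ u ⇔ q ≈ u * y
  qp≈u⇔q≈uy {p} {y} py≈1 q u = mk⇔
    (λ eq → begin
      q               ≈⟨ *-identityʳ q ⟨
      q * 1#          ≈⟨ *-congˡ py≈1 ⟨
      q * (p * y)     ≈⟨ *-assoc q p y ⟨
      q * p * y       ≈⟨ *-congʳ eq ⟩
      u * y           ∎)
    (λ eq → begin
      q * p           ≈⟨ *-congʳ eq ⟩
      u * y * p       ≈⟨ *-assoc u y p ⟩
      u * (y * p)     ≈⟨ *-congˡ (*-comm y p) ⟩
      u * (p * y)     ≈⟨ *-congˡ py≈1 ⟩
      u * 1#          ≈⟨ *-identityʳ u ⟩
      u               ∎)

  [a-x]p≈u⇔x≈a-uy : ∀ {p y} → p * y ≈ 1# → ∀ a x u → (a - x) * p ≈ u ⇔ x ≈ a - u * y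
  [a-x]p≈u⇔x≈a-uy py≈1 a x u = mk⇔
    (λ eq → trans (sym (a-[a-x]≈x a x)) (+-congˡ (-‿cong (to (qp≈u⇔q≈uy py≈1 (a - x) u) eq))))
    (λ eq → from (qp≈u⇔q≈uy py≈1 (a - x) u)
              (trans (+-congˡ (-‿cong eq)) (a-[a-x]≈x a (u * _))))

module Determinants {c ℓ : Level} (F : Field c ℓ) where
  open FieldMatrices F
  open Field F using (setoid; refl; sym; trans; reflexive; +-cong; +-congˡ; +-congʳ;
    *-cong; *-congˡ; *-congʳ; *-identityˡ; *-identityʳ; +-identityˡ; +-identityʳ;
    zeroʳ; distribˡ; +-assoc; +-comm; +-group; +-commutativeSemigroup; *-commutativeSemigroup;
    commutativeRing)
  open import Algebra.Properties.CommutativeSemigroup +-commutativeSemigroup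
    using (interchange; xy∙z≈xz∙y)
  open import Algebra.Properties.CommutativeSemigroup *-commutativeSemigroup
    using (x∙yz≈y∙xz)
  open import Algebra.Properties.Group +-group using (∙-cancelʳ)
  open import Relation.Binary.Reasoning.Setoid setoid
  open LinearEquations commutativeRing using ([a-x]p≈u⇔u+xp≈ap)

  ∑-cong : ∀ {m} {f g : Fin m → Carrier} → (∀ j → f j ≈ g j) → ∑ f ≈ ∑ g
  ∑-cong {zero}  f≈g = refl
  ∑-cong {suc m} f≈g = +-cong (f≈g zero) (∑-cong (f≈g ∘ suc))

  ∑-linear : ∀ {m} (f g : Fin m → Carrier) x → ∑ (λ j → f j + x * g j) ≈ ∑ f + x * ∑ g
  ∑-linear {zero}  f g x = sym (trans (+-congˡ (zeroʳ x)) (+-identityʳ 0#))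
  ∑-linear {suc m} f g x = begin
    (f zero + x * g zero) + ∑ (λ j → f (suc j) + x * g (suc j))
      ≈⟨ +-congˡ (∑-linear (f ∘ suc) (g ∘ suc) x) ⟩
    (f zero + x * g zero) + (∑ (f ∘ suc) + x * ∑ (g ∘ suc))
      ≈⟨ interchange _ _ _ _ ⟩
    (f zero + ∑ (f ∘ suc)) + (x * g zero + x * ∑ (g ∘ suc))
      ≈⟨ +-congˡ (distribˡ x _ _) ⟨
    ∑ f + x * ∑ g ∎

  ∑-last : ∀ {m} (f : Fin (suc m) → Carrier) → ∑ f ≈ ∑ (f ∘ inject₁) + f (fromℕ m)
  ∑-last {zero}  f = +-comm _ _
  ∑-last {suc m} f = trans (+-congˡ (∑-last (f ∘ suc))) (sym (+-assoc _ _ _))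

  sgn-inject₁ : ∀ {m} (j : Fin m) → sgn (inject₁ j) ≡ sgn j
  sgn-inject₁ zero    = ≡.refl
  sgn-inject₁ (suc j) = ≡.cong -_ (sgn-inject₁ j)

  det-cong : ∀ {m} (M N : Matrix m) → (∀ r s → M r s ≈ N r s) → det M ≈ det N
  det-cong {zero}  M N M≈N = refl
  det-cong {suc m} M N M≈N = ∑-cong λ j → *-congˡ {sgn j} (*-cong (M≈N zero j)
    (det-cong (minor M j) (minor N j) λ r s → M≈N (suc r) (punchIn j s)))

  det-cong-toℕ : ∀ {m m′} → m ≡ m′ → (M : Matrix m) (N : Matrix m′) →
    (∀ r r′ s s′ → toℕ r ≡ toℕ r′ → toℕ s ≡ toℕ s′ → M r s ≈ N r′ s′) → det M ≈ det N
  det-cong-toℕ ≡.refl M N M≈N = det-cong M N λ r s → M≈N r r s s ≡.refl ≡.refl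

  det₁ : (M : Matrix 1) → det M ≈ M zero zero
  det₁ M = trans (+-identityʳ _) (trans (*-identityˡ _) (*-identityʳ _))

  topLeft : ∀ {m} → Matrix (suc m) → Matrix m
  topLeft M r s = M (inject₁ r) (inject₁ s)

  corner : ∀ {m} → Matrix (suc m) → Carrier
  corner {m} M = M (fromℕ m) (fromℕ m)

  AgreeOffCorner : ∀ {m} → Matrix (suc m) → Matrix (suc m) → Set ℓ
  AgreeOffCorner {m} M M′ = (∀ r s → M′ (inject₁ r) s ≈ M (inject₁ r) s)
                          × (∀ s → M′ (fromℕ m) (inject₁ s) ≈ M (fromℕ m) (inject₁ s))

  agree-offLastColumn : ∀ {m} (M M′ : Matrix (suc m)) → AgreeOffCorner M M′ →
                        ∀ r s → M′ r (inject₁ s) ≈ M r (inject₁ s)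
  agree-offLastColumn M M′ (rows , lastRow) r s = byRow (view r)
    where
    byRow : ∀ {r} → View r → M′ r (inject₁ s) ≈ M r (inject₁ s)
    byRow ‵fromℕ         = lastRow s
    byRow (‵inject₁ r′) = rows r′ (inject₁ s)

  agree-minor : ∀ {m} (M M′ : Matrix (suc (suc m))) → AgreeOffCorner M M′ →
                ∀ j → AgreeOffCorner (minor M (inject₁ j)) (minor M′ (inject₁ j))
  agree-minor {m} M M′ (rows , lastRow) j =
    (λ r s → rows (suc r) (punchIn (inject₁ j) s)) ,
    (λ s → ≡.subst (λ t → M′ (fromℕ (suc m)) t ≈ M (fromℕ (suc m)) t)
                   (≡.sym (punchIn-inject₁ j s)) (lastRow (punchIn j s)))

  det-minor-topLeft : ∀ {m} (M : Matrix (suc (suc m))) j →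
                      det (minor (topLeft M) j) ≈ det (topLeft (minor M (inject₁ j)))
  det-minor-topLeft M j = det-cong _ _ λ r s →
    reflexive (≡.cong (M (suc (inject₁ r))) (≡.sym (punchIn-inject₁ j s)))

  scaled-affine : ∀ s a d x t → s * (a * (d + x * t)) ≈ s * (a * d) + x * (s * (a * t))
  scaled-affine s a d x t = begin
    s * (a * (d + x * t))          ≈⟨ *-congˡ (distribˡ a d (x * t)) ⟩
    s * (a * d + a * (x * t))      ≈⟨ distribˡ s _ _ ⟩
    s * (a * d) + s * (a * (x * t)) ≈⟨ +-congˡ (*-congˡ (x∙yz≈y∙xz a x t)) ⟩
    s * (a * d) + s * (x * (a * t)) ≈⟨ +-congˡ (x∙yz≈y∙xz s x (a * t)) ⟩
    s * (a * d) + x * (s * (a * t)) ∎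

  -- Induction on the size: in the first-row
  -- expansion, every term but the last is a cofactor of the same shape, and
  -- the last term does not involve the corner.
  det-corner : ∀ {m} (M M′ : Matrix (suc m)) → AgreeOffCorner M M′ →
    det M′ + corner M * det (topLeft M) ≈ det M + corner M′ * det (topLeft M)
  det-corner {zero} M M′ _ = begin
    det M′ + corner M * 1#    ≈⟨ +-cong (det₁ M′) (*-identityʳ _) ⟩
    corner M′ + corner M      ≈⟨ +-comm _ _ ⟩
    corner M + corner M′      ≈⟨ +-cong (det₁ M) (*-identityʳ _) ⟨
    det M + corner M′ * 1#    ∎
  det-corner {suc m} M M′ agree@(rows , _) = begin
    det M′ + x * ∑ Y
      ≈⟨ +-congʳ (∑-last T′) ⟩
    (∑ (T′ ∘ inject₁) + T′ L) + x * ∑ Y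
      ≈⟨ xy∙z≈xz∙y _ _ _ ⟩
    (∑ (T′ ∘ inject₁) + x * ∑ Y) + T′ L
      ≈⟨ +-congʳ (∑-linear (T′ ∘ inject₁) Y x) ⟨
    ∑ (λ j → T′ (inject₁ j) + x * Y j) + T′ L
      ≈⟨ +-cong (∑-cong cofactor-term) last-term ⟩
    ∑ (λ j → T (inject₁ j) + x′ * Y j) + T L
      ≈⟨ +-congʳ (∑-linear (T ∘ inject₁) Y x′) ⟩
    (∑ (T ∘ inject₁) + x′ * ∑ Y) + T L
      ≈⟨ xy∙z≈xz∙y _ _ _ ⟨
    (∑ (T ∘ inject₁) + T L) + x′ * ∑ Y
      ≈⟨ +-congʳ (∑-last T) ⟨
    det M + x′ * ∑ Y ∎
    where
    L  = fromℕ (suc m)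
    x  = corner M
    x′ = corner M′
    T T′ : Fin (suc (suc m)) → Carrier
    T  j = sgn j * (M zero j * det (minor M j))
    T′ j = sgn j * (M′ zero j * det (minor M′ j))
    Y : Fin (suc m) → Carrier
    Y j = sgn j * (M zero (inject₁ j) * det (minor (topLeft M) j))

    cofactor-term : ∀ j → T′ (inject₁ j) + x * Y j ≈ T (inject₁ j) + x′ * Y j
    cofactor-term j = begin
      T′ (inject₁ j) + x * Y j        ≈⟨ +-cong (*-congˡ (*-congʳ (rows zero (inject₁ j))))
                                                (*-congˡ Y-as-cofactor) ⟩
      s * (a * d′) + x * (s * (a * t)) ≈⟨ scaled-affine s a d′ x t ⟨
      s * (a * (d′ + x * t))           ≈⟨ *-congˡ (*-congˡ induction) ⟩
      s * (a * (d + x′ * t))           ≈⟨ scaled-affine s a d x′ t ⟩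
      T (inject₁ j) + x′ * (s * (a * t)) ≈⟨ +-congˡ (*-congˡ Y-as-cofactor) ⟨
      T (inject₁ j) + x′ * Y j         ∎
      where
      s = sgn (inject₁ j)
      a = M zero (inject₁ j)
      d = det (minor M (inject₁ j))
      d′ = det (minor M′ (inject₁ j))
      t = det (topLeft (minor M (inject₁ j)))
      Y-as-cofactor : Y j ≈ s * (a * t)
      Y-as-cofactor = *-cong (reflexive (≡.sym (sgn-inject₁ j))) (*-congˡ (det-minor-topLeft M j))
      corner-minor : ∀ N → corner (minor N (inject₁ j)) ≡ corner N
      corner-minor N = ≡.cong (N L) (punchIn-inject₁-fromℕ j)
      induction : d′ + x * t ≈ d + x′ * t
      induction = ≡.subst₂ (λ y y′ → d′ + y * t ≈ d + y′ * t) (corner-minor M) (corner-minor M′)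
        (det-corner (minor M (inject₁ j)) (minor M′ (inject₁ j)) (agree-minor M M′ agree j))

    -- deleting the last column removes the corner entirely
    last-term : T′ L ≈ T L
    last-term = *-congˡ (*-cong (rows zero L) (det-cong _ _ λ r s →
      ≡.subst (λ t → M′ (suc r) t ≈ M (suc r) t) (≡.sym (punchIn-fromℕ s))
              (agree-offLastColumn M M′ agree (suc r) s)))

  setDiag-diag : ∀ {k} (M : Matrix k) i b r s → r ≡ i → s ≡ i → setDiag M i b r s ≈ b
  setDiag-diag M i b .i .i ≡.refl ≡.refl with i ≟ i
  ... | yes _   = refl
  ... | no i≢i = ⊥-elim (i≢i ≡.refl)

  setDiag-offRow : ∀ {k} (M : Matrix k) i b r s → r ≢ i → setDiag M i b r s ≈ M r s
  setDiag-offRow M i b r s r≢i with r ≟ i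
  ... | yes r≡i = ⊥-elim (r≢i r≡i)
  ... | no _    = refl

  setDiag-offColumn : ∀ {k} (M : Matrix k) i b r s → s ≢ i → setDiag M i b r s ≈ M r s
  setDiag-offColumn M i b r s s≢i with r ≟ i | s ≟ i
  ... | _     | yes s≡i = ⊥-elim (s≢i s≡i)
  ... | yes _ | no _    = refl
  ... | no _  | no _    = refl

  lead-corner-index : ∀ {k} (i : Fin k) → inject≤ (fromℕ (toℕ i)) (toℕ<n i) ≡ i
  lead-corner-index i = toℕ-injective (≡.trans (toℕ-inject≤ (fromℕ (toℕ i)) (toℕ<n i)) (toℕ-fromℕ (toℕ i)))

  lead-inner-index : ∀ {k} (i : Fin k) (r : Fin (toℕ i)) → inject≤ (inject₁ r) (toℕ<n i) ≢ i
  lead-inner-index i r eq = <-irrefl toℕr≡toℕi (toℕ<n r)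
    where
    toℕr≡toℕi : toℕ r ≡ toℕ i
    toℕr≡toℕi = ≡.trans (≡.sym (≡.trans (toℕ-inject≤ (inject₁ r) (toℕ<n i)) (toℕ-inject₁ r)))
                        (≡.cong toℕ eq)

  corner-lead : ∀ {k} (M : Matrix k) i → corner (lead M i) ≈ M i i
  corner-lead M i = reflexive (≡.cong₂ M (lead-corner-index i) (lead-corner-index i))

  corner-leadWith : ∀ {k} (M : Matrix k) i x → corner (leadWith M i x) ≈ x
  corner-leadWith M i x = setDiag-diag M i x _ _ (lead-corner-index i) (lead-corner-index i)

  lead-agree : ∀ {k} (M : Matrix k) i x → AgreeOffCorner (lead M i) (leadWith M i x)
  lead-agree M i x =
    (λ r s → setDiag-offRow M i x _ _ (lead-inner-index i r)) ,
    (λ s → setDiag-offColumn M i x _ _ (lead-inner-index i s))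

  det-topLeft-lead : ∀ {n} (M : Matrix (suc n)) (j : Fin n) →
                     det (topLeft (lead M (suc j))) ≈ det (lead M (inject₁ j))
  det-topLeft-lead M j = det-cong-toℕ (≡.cong suc (≡.sym (toℕ-inject₁ j))) _ _
    λ r r′ s s′ r≡r′ s≡s′ → reflexive (≡.cong₂ M (same-index r r′ r≡r′) (same-index s s′ s≡s′))
    where
    same-index : ∀ r r′ → toℕ r ≡ toℕ r′ →
                 inject≤ (inject₁ r) (toℕ<n (suc j)) ≡ inject≤ r′ (toℕ<n (inject₁ j))
    same-index r r′ r≡r′ = toℕ-injective (≡.trans (toℕ-inject≤ (inject₁ r) _)
      (≡.trans (toℕ-inject₁ r) (≡.trans r≡r′ (≡.sym (toℕ-inject≤ r′ _)))))

  det-leadWith : ∀ {n} (A : Matrix (suc n)) (j : Fin n) x →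
    det (leadWith A (suc j) x) + A (suc j) (suc j) * det (lead A (inject₁ j))
      ≈ det (lead A (suc j)) + x * det (lead A (inject₁ j))
  det-leadWith A j x = begin
    det A′ + A (suc j) (suc j) * det (lead A (inject₁ j))
      ≈⟨ +-congˡ (*-cong (corner-lead A (suc j)) (det-topLeft-lead A j)) ⟨
    det A′ + corner Aⱼ * det (topLeft Aⱼ)
      ≈⟨ det-corner Aⱼ A′ (lead-agree A (suc j) x) ⟩
    det Aⱼ + corner A′ * det (topLeft Aⱼ)
      ≈⟨ +-congˡ (*-cong (corner-leadWith A (suc j) x) (det-topLeft-lead A j)) ⟩
    det Aⱼ + x * det (lead A (inject₁ j)) ∎
    where
    Aⱼ = lead A (suc j)
    A′ = leadWith A (suc j) x

  det-leadWith≈0⇔ : ∀ {n} (A : Matrix (suc n)) (j : Fin n) x →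
    det (leadWith A (suc j) x) ≈ 0#
      ⇔ (A (suc j) (suc j) - x) * det (lead A (inject₁ j)) ≈ det (lead A (suc j))
  det-leadWith≈0⇔ A j x = mk⇔
    (λ vanishes → from ([a-x]p≈u⇔u+xp≈ap a x p u) (begin
      u + x * p            ≈⟨ det-leadWith A j x ⟨
      det A′ + a * p       ≈⟨ +-congʳ vanishes ⟩
      0# + a * p           ≈⟨ +-identityˡ _ ⟩
      a * p                ∎))
    (λ root → ∙-cancelʳ (a * p) (det A′) 0# (begin
      det A′ + a * p       ≈⟨ det-leadWith A j x ⟩
      u + x * p            ≈⟨ to ([a-x]p≈u⇔u+xp≈ap a x p u) root ⟩
      a * p                ≈⟨ +-identityˡ _ ⟨
      0# + a * p           ∎))
    where
    a = A (suc j) (suc j)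
    p = det (lead A (inject₁ j))
    u = det (lead A (suc j))
    A′ = leadWith A (suc j) x

module Construction {c ℓ : Level} (F : Field c ℓ) where
  open FieldMatrices F
  open Field F using (refl; sym; trans; *-congˡ; inverse; commutativeRing)
  open Determinants F using (det₁; det-leadWith≈0⇔)
  open LinearEquations commutativeRing using ([a-x]p≈u⇔x≈a-uy)

  module Solution {n : ℕ} (A : Matrix (suc n)) (lead-nonsingular : ∀ i → ¬ (det (lead A i) ≈ 0#)) where
    D : Fin (suc n) → Carrier
    D i = det (lead A i)

    D⁻¹ : Fin n → Carrier
    D⁻¹ j = proj₁ (inverse (D (inject₁ j)) (lead-nonsingular (inject₁ j)))

    D*D⁻¹≈1 : ∀ j → D (inject₁ j) * D⁻¹ j ≈ 1#
    D*D⁻¹≈1 j = proj₂ (inverse (D (inject₁ j)) (lead-nonsingular (inject₁ j)))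

    -- the unique root of (a_{j+1,j+1} - x)·D_j = D_{j+1}
    b : Fin n → Carrier
    b j = A (suc j) (suc j) - D (suc j) * D⁻¹ j

    root⇔ : ∀ j x → (A (suc j) (suc j) - x) * D (inject₁ j) ≈ D (suc j) ⇔ x ≈ b j
    root⇔ j x = [a-x]p≈u⇔x≈a-uy (D*D⁻¹≈1 j) (A (suc j) (suc j)) x (D (suc j))

    b-root : ∀ j → (A (suc j) (suc j) - b j) * D (inject₁ j) ≈ D (suc j)
    b-root j = from (root⇔ j (b j)) refl

    conds : Conds A b D
    conds = det₁ (lead A zero)
          , (λ j → sym (b-root j))
          , (λ j → from (det-leadWith≈0⇔ A j (b j)) (b-root j))

    -- Condition (c) pins down b′, and then (a),(b) determine d′ by induction.
    unique : ∀ b′ d′ → Conds A b′ d′ → (∀ j → b′ j ≈ b j) × (∀ i → d′ i ≈ D i)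
    unique b′ d′ (d′₀ , d′-step , vanishes) = b′≈b , d′≈D
      where
      b′-root : ∀ j → (A (suc j) (suc j) - b′ j) * D (inject₁ j) ≈ D (suc j)
      b′-root j = to (det-leadWith≈0⇔ A j (b′ j)) (vanishes j)
      b′≈b : ∀ j → b′ j ≈ b j
      b′≈b j = to (root⇔ j (b′ j)) (b′-root j)
      d′≈D : ∀ i → d′ i ≈ D i
      d′≈D = <-weakInduction (λ i → d′ i ≈ D i) (trans d′₀ (sym (det₁ (lead A zero))))
        λ j d′ⱼ≈Dⱼ → trans (d′-step j) (trans (*-congˡ d′ⱼ≈Dⱼ) (b′-root j))

proposition11 : {c ℓ : Level} (F : Field c ℓ) → let open FieldMatrices F in
    (n : ℕ) (A : Matrix (suc n)) →
    (∀ i → ¬ (A i i ≈ 0#)) →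
    (∀ i → ¬ (det (lead A i) ≈ 0#)) →
    Σ (Fin n → Carrier) λ b → Σ (Fin (suc n) → Carrier) λ d →
    Conds A b d
    × (∀ b′ d′ → Conds A b′ d′ → (∀ j → b′ j ≈ b j) × (∀ i → d′ i ≈ d i))
    × (∀ i → d i ≈ det (lead A i))
proposition11 F n A _ lead-nonsingular =
  b , D , conds , unique , (λ i → Field.refl F)
  where open Construction.Solution F A lead-nonsingular
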